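{- Let $\mathcal{R}$ be a region and $w\in\Delta$, and let $r:\mathbb{R}^3\to\mathbb{R}^3$, $r(p)=p-2(p\cdot w)w$ (so $r(\mathcal{R})$ is a region). If $t$ is a tiling of $\mathcal{R}$ and $u\in\Phi$, then the tiling $r(t)=\{r(d):d\in t\}$ of $r(\mathcal{R})$ satisfies $T^u(r(t))=-T^u(t)$.
   Context: A basic cube is $C=(x,y,z)+[0,1]^3$ with $(x,y,z)\in\mathbb{Z}^3$; it is black if $x+y+z$ is odd and white if even. A region is a finite union of basic cubes; a domino is the union of two basic cubes sharing a face; a tiling of a region is a set of dominoes with pairwise disjoint interiors whose union is the region. $\Phi=\{\pm e_x,\pm e_y,\pm e_z\}$, $\Delta=\{e_x,e_y,e_z\}$. For a domino $d$, $v(d)\in\Phi$ is the center of its black cube minus the center of its white cube. $\det(a,b,c)=a\cdot(b\times c)$. For $X\subset\mathbb{R}^3$, $u\in\Phi$, $S^u(X)=\operatorname{int}\big((X+[0,\infty)u)\setminus X\big)$. For dominoes $d_0,d_1$, $\tau^u(d_0,d_1)=\frac14\det(v(d_1),v(d_0),u)$ if $d_1\cap S^u(d_0)\neq\emptyset$ and $0$ otherwise; the $u$-pretwist is $T^u(t)=\sum_{d_0,d_1\in t}\tau^u(d_0,d_1)$ over ordered pairs. -}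

module Defs where

open import Data.Bool using (Bool; true; false; if_then_else_; _∧_; _∨_; not)
open import Data.Nat as ℕ using (ℕ; _%_)
import Data.Nat.Properties as ℕP
open import Data.Integer as ℤ using (ℤ; +_; ∣_∣)
open import Data.Rational as ℚ using (ℚ; 0ℚ; _/_)
open import Data.Product using (_×_; _,_; proj₁; proj₂; ∃)
open import Data.Sum using (_⊎_)
open import Data.Empty using (⊥)
open import Data.List using (List; []; _∷_; map; foldr)
open import Data.Bool.ListAction using (any)
open import Data.List.Relation.Unary.All using (All)
open import Data.List.Relation.Unary.Any using (Any)
open import Data.List.Relation.Unary.AllPairs using (AllPairs)
open import Data.List.Membership.Propositional using (_∈_)
open import Relation.Nullary.Decidable using (⌊_⌋)
open import Relation.Binary.PropositionalEquality using (_≡_)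
open import Function.Bundles using (_⇔_)

-- Lattice points of ℤ³.  A basic cube (x,y,z)+[0,1]³ is represented by
-- its minimal corner (x,y,z).

Point : Set
Point = ℤ × ℤ × ℤ

Cube : Set
Cube = Point

_⊕_ : Point → Point → Point
(a , b , c) ⊕ (a' , b' , c') = (a ℤ.+ a') , (b ℤ.+ b') , (c ℤ.+ c')

_⊖_ : Point → Point → Point
(a , b , c) ⊖ (a' , b' , c') = (a ℤ.- a') , (b ℤ.- b') , (c ℤ.- c')

det : Point → Point → Point → ℤ
det (a₁ , a₂ , a₃) (b₁ , b₂ , b₃) (c₁ , c₂ , c₃) =
  a₁ ℤ.* (b₂ ℤ.* c₃ ℤ.- b₃ ℤ.* c₂)
  ℤ.+ a₂ ℤ.* (b₃ ℤ.* c₁ ℤ.- b₁ ℤ.* c₃)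
  ℤ.+ a₃ ℤ.* (b₁ ℤ.* c₂ ℤ.- b₂ ℤ.* c₁)

data Dir : Set where
  px nx py ny pz nz : Dir

vec : Dir → Point
vec px = + 1 , + 0 , + 0
vec nx = ℤ.- + 1 , + 0 , + 0
vec py = + 0 , + 1 , + 0
vec ny = + 0 , ℤ.- + 1 , + 0
vec pz = + 0 , + 0 , + 1
vec nz = + 0 , + 0 , ℤ.- + 1

data Axis : Set where
  X Y Z : Axis

isBlack : Cube → Bool
isBlack (x , y , z) = ⌊ (∣ x ℤ.+ y ℤ.+ z ∣ % 2) ℕP.≟ 1 ⌋

Adjacent : Cube → Cube → Set
Adjacent c₁ c₂ = ∃ λ (φ : Dir) → c₂ ≡ c₁ ⊕ vec φ

Domino : Set
Domino = Cube × Cube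

IsDomino : Domino → Set
IsDomino (c₁ , c₂) = Adjacent c₁ c₂

InDomino : Cube → Domino → Set
InDomino c (c₁ , c₂) = c ≡ c₁ ⊎ c ≡ c₂

-- v(d) = centre of black cube − centre of white cube
v : Domino → Point
v (c₁ , c₂) = if isBlack c₁ then c₁ ⊖ c₂ else c₂ ⊖ c₁

Region : Set
Region = List Cube

Disjoint : Domino → Domino → Set
Disjoint d e = ∀ c → InDomino c d → InDomino c e → ⊥

IsTiling : Region → List Domino → Set
IsTiling R t =
  All IsDomino t × AllPairs Disjoint t × (∀ c → (c ∈ R) ⇔ Any (InDomino c) t)

-- The reflection r(p) = p − 2(p·w)w on cubes: the cube (x,y,z)+[0,1]³
-- is sent to the cube with minimal corner (−x−1,y,z) (for w = e_x), etc.

reflectCube : Axis → Cube → Cube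
reflectCube X (x , y , z) = (ℤ.- x ℤ.- + 1) , y , z
reflectCube Y (x , y , z) = x , (ℤ.- y ℤ.- + 1) , z
reflectCube Z (x , y , z) = x , y , (ℤ.- z ℤ.- + 1)

reflectDomino : Axis → Domino → Domino
reflectDomino w (c₁ , c₂) = reflectCube w c₁ , reflectCube w c₂

-- d₁ ∩ S^u(d₀) ≠ ∅.  For dominoes made of basic cubes this holds iff
-- some cube c₁ of d₁ equals c₀ + k u for a cube c₀ of d₀ and k ≥ 1,
-- with c₁ not a cube of d₀.

infix 4 _==ℤ_ _<ℤ_ _==ᵖ_

_==ℤ_ : ℤ → ℤ → Bool
a ==ℤ b = ⌊ a ℤ.≟ b ⌋

_<ℤ_ : ℤ → ℤ → Bool
a <ℤ b = ⌊ a ℤ.<? b ⌋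

_==ᵖ_ : Point → Point → Bool
(a , b , c) ==ᵖ (a' , b' , c') = (a ==ℤ a') ∧ (b ==ℤ b') ∧ (c ==ℤ c')

positiveMultiple : Dir → Point → Bool
positiveMultiple px (x , y , z) = (+ 0 <ℤ x) ∧ (y ==ℤ + 0) ∧ (z ==ℤ + 0)
positiveMultiple nx (x , y , z) = (x <ℤ + 0) ∧ (y ==ℤ + 0) ∧ (z ==ℤ + 0)
positiveMultiple py (x , y , z) = (x ==ℤ + 0) ∧ (+ 0 <ℤ y) ∧ (z ==ℤ + 0)
positiveMultiple ny (x , y , z) = (x ==ℤ + 0) ∧ (y <ℤ + 0) ∧ (z ==ℤ + 0)
positiveMultiple pz (x , y , z) = (x ==ℤ + 0) ∧ (y ==ℤ + 0) ∧ (+ 0 <ℤ z)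
positiveMultiple nz (x , y , z) = (x ==ℤ + 0) ∧ (y ==ℤ + 0) ∧ (z <ℤ + 0)

cubeIn : Cube → Domino → Bool
cubeIn c (c₁ , c₂) = (c ==ᵖ c₁) ∨ (c ==ᵖ c₂)

cubeList : Domino → List Cube
cubeList (c₁ , c₂) = c₁ ∷ c₂ ∷ []

meetsShadow : Dir → Domino → Domino → Bool
meetsShadow u d₀ d₁ =
  any (λ c₁ → any (λ c₀ → positiveMultiple u (c₁ ⊖ c₀) ∧ not (cubeIn c₁ d₀))
                  (cubeList d₀))
      (cubeList d₁)

τ : Dir → Domino → Domino → ℚ
τ u d₀ d₁ = if meetsShadow u d₀ d₁ then det (v d₁) (v d₀) (vec u) / 4 else 0ℚ

sumℚ : List ℚ → ℚ
sumℚ = foldr ℚ._+_ 0ℚ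

pretwist : Dir → List Domino → ℚ
pretwist u t = sumℚ (map (λ d₀ → sumℚ (map (λ d₁ → τ u d₀ d₁) t)) t)

{-# OPTIONS --safe #-}
module Submission where

-- Let ρ be the linear part of r (negation of the w-coordinate). The reflection r
-- swaps the two colours, so v(r d) = ρ(−v d); it carries the u-shadow of d₀ to the
-- ρu-shadow of r d₀; and det(−ρa, −ρb, c) = −det(a, b, ρc) because det ρ = −1.
-- Hence τ^u(r d₀, r d₁) = −τ^{ρu}(d₀, d₁) and T^u(r t) = −T^{ρu}(t). Finally ρu = ±u,
-- and T^{−u}(t) = T^u(t): τ^{−u}(d₀, d₁) = τ^u(d₁, d₀) for two distinct, hence
-- disjoint, dominoes of t, and both vanish when d₀ = d₁.

open import Defs
open import Algebra.Bundles using (CommutativeMonoid)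
open import Data.Bool using (Bool; true; false; not; _∧_; _∨_; _xor_; if_then_else_; T)
open import Data.Bool.Properties
  using (∧-identityʳ; ∨-commutativeMonoid; not-distribˡ-xor; not-distribʳ-xor; xor-comm;
         xor-identityʳ; if-eta; T-∧)
open import Data.Bool.ListAction using (any)
open import Data.Integer as ℤ using (ℤ; +_; -[1+_]; +[1+_]; ∣_∣)
import Data.Integer.Properties as ℤP
open import Data.Integer.Tactic.RingSolver using (solve-∀)
open import Data.List using (List; []; _∷_; map; foldr)
open import Data.List.Membership.Propositional using (_∈_)
open import Data.List.Relation.Unary.All as All using ()
open import Data.List.Relation.Unary.AllPairs using (AllPairs; _∷_)
open import Data.List.Relation.Unary.Any using (here; there)
open import Data.Nat as ℕ using (ℕ; zero; suc; _%_)
import Data.Nat.Properties as ℕP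
open import Data.Product using (_,_)
open import Data.Rational as ℚ using (ℚ; 0ℚ; _/_)
import Data.Rational.Properties as ℚP
open import Data.Sum using (_⊎_; inj₁; inj₂)
open import Function using (_∘_; flip; _⇔_; mk⇔; Equivalence)
open import Relation.Binary.Definitions using (DecidableEquality; Symmetric)
open import Relation.Binary.PropositionalEquality using (_≡_; refl; sym; trans; cong; cong₂; module ≡-Reasoning)
open import Relation.Nullary using (¬_)
open import Relation.Nullary.Decidable
  using (Dec; ⌊_⌋; _because_; isYes≗does; does-⇔; dec-false; toWitness; fromWitness)
open import Relation.Nullary.Reflects using (fromEquivalence)

open Equivalence using (to; from)

module ListSum {c ℓ} (M : CommutativeMonoid c ℓ) where
  open CommutativeMonoid M
    renaming (refl to ≈-refl; sym to ≈-sym; trans to ≈-trans)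
  open import Algebra.Properties.CommutativeSemigroup commutativeSemigroup using (interchange)
  open import Relation.Binary.Reasoning.Setoid setoid

  ∑ : ∀ {a} {A : Set a} → (A → Carrier) → List A → Carrier
  ∑ f xs = foldr _∙_ ε (map f xs)

  ∑-ε : ∀ {a} {A : Set a} (xs : List A) → ∑ (λ _ → ε) xs ≈ ε
  ∑-ε []       = ≈-refl
  ∑-ε (_ ∷ xs) = ≈-trans (identityˡ _) (∑-ε xs)

  ∑-∙ : ∀ {a} {A : Set a} (f g : A → Carrier) xs →
        ∑ (λ x → f x ∙ g x) xs ≈ ∑ f xs ∙ ∑ g xs
  ∑-∙ f g []       = ≈-sym (identityˡ ε)
  ∑-∙ f g (x ∷ xs) = begin
    (f x ∙ g x) ∙ ∑ (λ x → f x ∙ g x) xs  ≈⟨ ∙-congˡ (∑-∙ f g xs) ⟩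
    (f x ∙ g x) ∙ (∑ f xs ∙ ∑ g xs)       ≈⟨ interchange _ _ _ _ ⟩
    (f x ∙ ∑ f xs) ∙ (g x ∙ ∑ g xs)       ∎

  ∑-comm : ∀ {a b} {A : Set a} {B : Set b} (f : A → B → Carrier) xs ys →
           ∑ (λ x → ∑ (f x) ys) xs ≈ ∑ (λ y → ∑ (λ x → f x y) xs) ys
  ∑-comm f []       ys = ≈-sym (∑-ε ys)
  ∑-comm f (x ∷ xs) ys = begin
    ∑ (f x) ys ∙ ∑ (λ x → ∑ (f x) ys) xs          ≈⟨ ∙-congˡ (∑-comm f xs ys) ⟩
    ∑ (f x) ys ∙ ∑ (λ y → ∑ (λ x → f x y) xs) ys  ≈⟨ ∑-∙ (f x) _ ys ⟨
    ∑ (λ y → f x y ∙ ∑ (λ x → f x y) xs) ys       ∎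

  ∑-cong-local : ∀ {a} {A : Set a} {f g : A → Carrier} xs →
                 (∀ {x} → x ∈ xs → f x ≡ g x) → ∑ f xs ≡ ∑ g xs
  ∑-cong-local []       f≡g = refl
  ∑-cong-local (x ∷ xs) f≡g = cong₂ _∙_ (f≡g (here refl)) (∑-cong-local xs (f≡g ∘ there))

  ∑-map-cong : ∀ {a b} {A : Set a} {B : Set b} (h : A → B) {f : B → Carrier} {g : A → Carrier} →
               (∀ x → f (h x) ≡ g x) → ∀ xs → ∑ f (map h xs) ≡ ∑ g xs
  ∑-map-cong h fh≡g []       = refl
  ∑-map-cong h fh≡g (x ∷ xs) = cong₂ _∙_ (fh≡g x) (∑-map-cong h fh≡g xs)

open ListSum ∨-commutativeMonoid using ()
  renaming (∑-comm to any-comm; ∑-cong-local to any-cong-local)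

AllPairs-lookup : ∀ {a r} {A : Set a} {R : A → A → Set r} {xs x y} → Symmetric R →
                  AllPairs R xs → x ∈ xs → y ∈ xs → x ≡ y ⊎ R x y
AllPairs-lookup R-sym (_  ∷ _)     (here refl) (here refl) = inj₁ refl
AllPairs-lookup R-sym (Rx ∷ _)     (here refl) (there y∈) = inj₂ (All.lookup Rx y∈)
AllPairs-lookup R-sym (Rx ∷ _)     (there x∈) (here refl) = inj₂ (R-sym (All.lookup Rx x∈))
AllPairs-lookup R-sym (_  ∷ pairs) (there x∈) (there y∈)  = AllPairs-lookup R-sym pairs x∈ y∈

isOddℕ : ℕ → Bool
isOddℕ k = ⌊ k % 2 ℕP.≟ 1 ⌋

isOddℕ-suc : ∀ k → isOddℕ (suc k) ≡ not (isOddℕ k)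
isOddℕ-suc zero          = refl
isOddℕ-suc (suc zero)    = refl
isOddℕ-suc (suc (suc k)) = isOddℕ-suc k

isOdd : ℤ → Bool
isOdd i = isOddℕ ∣ i ∣

isOdd-neg : ∀ i → isOdd (ℤ.- i) ≡ isOdd i
isOdd-neg i = cong isOddℕ (ℤP.∣-i∣≡∣i∣ i)

isOdd-suc : ∀ i → isOdd (ℤ.suc i) ≡ not (isOdd i)
isOdd-suc (+ k)        = isOddℕ-suc k
isOdd-suc -[1+ zero ]  = refl
isOdd-suc -[1+ suc k ] = isOddℕ-suc k

isOdd-+-nonNeg : ∀ i k → isOdd (i ℤ.+ + k) ≡ isOdd i xor isOddℕ k
isOdd-+-nonNeg i zero    = trans (cong isOdd (ℤP.+-identityʳ i)) (sym (xor-identityʳ _))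
isOdd-+-nonNeg i (suc k) = begin
  isOdd (i ℤ.+ ℤ.suc (+ k))     ≡⟨ cong isOdd (+-suc i (+ k)) ⟩
  isOdd (ℤ.suc (i ℤ.+ + k))     ≡⟨ isOdd-suc (i ℤ.+ + k) ⟩
  not (isOdd (i ℤ.+ + k))       ≡⟨ cong not (isOdd-+-nonNeg i k) ⟩
  not (isOdd i xor isOddℕ k)    ≡⟨ not-distribʳ-xor (isOdd i) (isOddℕ k) ⟩
  isOdd i xor not (isOddℕ k)    ≡⟨ cong (isOdd i xor_) (isOddℕ-suc k) ⟨
  isOdd i xor isOddℕ (suc k)    ∎
  where
  open ≡-Reasoning
  open import Data.Integer using (_+_; 1ℤ)
  +-suc : ∀ i j → i + (1ℤ + j) ≡ 1ℤ + (i + j)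
  +-suc = solve-∀

isOdd-+ : ∀ i j → isOdd (i ℤ.+ j) ≡ isOdd i xor isOdd j
isOdd-+ i (+ k)    = isOdd-+-nonNeg i k
isOdd-+ i -[1+ k ] = begin
  isOdd (i ℤ.+ -[1+ k ])               ≡⟨ cong isOdd (+-neg i (+ suc k)) ⟩
  isOdd (ℤ.- (ℤ.- i ℤ.+ + suc k))      ≡⟨ isOdd-neg (ℤ.- i ℤ.+ + suc k) ⟩
  isOdd (ℤ.- i ℤ.+ + suc k)            ≡⟨ isOdd-+-nonNeg (ℤ.- i) (suc k) ⟩
  isOdd (ℤ.- i) xor isOddℕ (suc k)     ≡⟨ cong (_xor _) (isOdd-neg i) ⟩
  isOdd i xor isOdd -[1+ k ]           ∎
  where
  open ≡-Reasoning
  open import Data.Integer using (_+_; -_)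
  +-neg : ∀ i j → i + - j ≡ - (- i + j)
  +-neg = solve-∀

isOdd-flipˡ : ∀ i i′ j → isOdd i′ ≡ not (isOdd i) → isOdd (i′ ℤ.+ j) ≡ not (isOdd (i ℤ.+ j))
isOdd-flipˡ i i′ j i′≡¬i rewrite isOdd-+ i′ j | isOdd-+ i j | i′≡¬i =
  sym (not-distribˡ-xor (isOdd i) (isOdd j))

isOdd-flipʳ : ∀ i j j′ → isOdd j′ ≡ not (isOdd j) → isOdd (i ℤ.+ j′) ≡ not (isOdd (i ℤ.+ j))
isOdd-flipʳ i j j′ j′≡¬j rewrite isOdd-+ i j′ | isOdd-+ i j | j′≡¬j =
  sym (not-distribʳ-xor (isOdd i) (isOdd j))

-- The cube [i, i + 1] of one coordinate is mirrored to [−i − 1, −i].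
reflectℤ : ℤ → ℤ
reflectℤ i = ℤ.- i ℤ.- + 1

reflectℤ-involutive : ∀ i → reflectℤ (reflectℤ i) ≡ i
reflectℤ-involutive = identity
  where
  open import Data.Integer using (_-_; -_)
  identity : ∀ i → - (- i - + 1) - + 1 ≡ i
  identity = solve-∀

reflectℤ-minus : ∀ i j → reflectℤ i ℤ.- reflectℤ j ≡ ℤ.- (i ℤ.- j)
reflectℤ-minus = identity
  where
  open import Data.Integer using (_-_; -_)
  identity : ∀ i j → (- i - + 1) - (- j - + 1) ≡ - (i - j)
  identity = solve-∀

isOdd-reflectℤ : ∀ i → isOdd (reflectℤ i) ≡ not (isOdd i)
isOdd-reflectℤ i = begin
  isOdd (ℤ.- i ℤ.+ -[1+ 0 ])  ≡⟨ isOdd-+ (ℤ.- i) -[1+ 0 ] ⟩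
  isOdd (ℤ.- i) xor true      ≡⟨ cong (_xor true) (isOdd-neg i) ⟩
  isOdd i xor true            ≡⟨ xor-comm _ true ⟩
  not (isOdd i)               ∎
  where open ≡-Reasoning

-- isBlack (x , y , z) unfolds to isOdd (x + y + z).
isBlack-reflectCube : ∀ w c → isBlack (reflectCube w c) ≡ not (isBlack c)
isBlack-reflectCube X (x , y , z) =
  isOdd-flipˡ (x ℤ.+ y) (reflectℤ x ℤ.+ y) z (isOdd-flipˡ x (reflectℤ x) y (isOdd-reflectℤ x))
isBlack-reflectCube Y (x , y , z) =
  isOdd-flipˡ (x ℤ.+ y) (x ℤ.+ reflectℤ y) z (isOdd-flipʳ x y (reflectℤ y) (isOdd-reflectℤ y))
isBlack-reflectCube Z (x , y , z) =
  isOdd-flipʳ (x ℤ.+ y) z (reflectℤ z) (isOdd-reflectℤ z)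

-ᵖ_ : Point → Point
-ᵖ (x , y , z) = ℤ.- x , ℤ.- y , ℤ.- z

mirror : Axis → Point → Point
mirror X (x , y , z) = ℤ.- x , y , z
mirror Y (x , y , z) = x , ℤ.- y , z
mirror Z (x , y , z) = x , y , ℤ.- z

opposite : Dir → Dir
opposite px = nx
opposite nx = px
opposite py = ny
opposite ny = py
opposite pz = nz
opposite nz = pz

mirrorDir : Axis → Dir → Dir
mirrorDir X px = nx
mirrorDir X nx = px
mirrorDir Y py = ny
mirrorDir Y ny = py
mirrorDir Z pz = nz
mirrorDir Z nz = pz
mirrorDir _ u  = u

vec-opposite : ∀ u → vec (opposite u) ≡ -ᵖ vec u
vec-opposite px = refl
vec-opposite nx = refl
vec-opposite py = refl
vec-opposite ny = refl
vec-opposite pz = refl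
vec-opposite nz = refl

vec-mirrorDir : ∀ w u → vec (mirrorDir w u) ≡ mirror w (vec u)
vec-mirrorDir X px = refl
vec-mirrorDir X nx = refl
vec-mirrorDir X py = refl
vec-mirrorDir X ny = refl
vec-mirrorDir X pz = refl
vec-mirrorDir X nz = refl
vec-mirrorDir Y px = refl
vec-mirrorDir Y nx = refl
vec-mirrorDir Y py = refl
vec-mirrorDir Y ny = refl
vec-mirrorDir Y pz = refl
vec-mirrorDir Y nz = refl
vec-mirrorDir Z px = refl
vec-mirrorDir Z nx = refl
vec-mirrorDir Z py = refl
vec-mirrorDir Z ny = refl
vec-mirrorDir Z pz = refl
vec-mirrorDir Z nz = refl

mirrorDir≡id⊎opposite : ∀ w u → mirrorDir w u ≡ u ⊎ mirrorDir w u ≡ opposite u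
mirrorDir≡id⊎opposite X px = inj₂ refl
mirrorDir≡id⊎opposite X nx = inj₂ refl
mirrorDir≡id⊎opposite X py = inj₁ refl
mirrorDir≡id⊎opposite X ny = inj₁ refl
mirrorDir≡id⊎opposite X pz = inj₁ refl
mirrorDir≡id⊎opposite X nz = inj₁ refl
mirrorDir≡id⊎opposite Y px = inj₁ refl
mirrorDir≡id⊎opposite Y nx = inj₁ refl
mirrorDir≡id⊎opposite Y py = inj₂ refl
mirrorDir≡id⊎opposite Y ny = inj₂ refl
mirrorDir≡id⊎opposite Y pz = inj₁ refl
mirrorDir≡id⊎opposite Y nz = inj₁ refl
mirrorDir≡id⊎opposite Z px = inj₁ refl
mirrorDir≡id⊎opposite Z nx = inj₁ refl
mirrorDir≡id⊎opposite Z py = inj₁ refl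
mirrorDir≡id⊎opposite Z ny = inj₁ refl
mirrorDir≡id⊎opposite Z pz = inj₂ refl
mirrorDir≡id⊎opposite Z nz = inj₂ refl

⊖-anticomm : ∀ a b → a ⊖ b ≡ -ᵖ (b ⊖ a)
⊖-anticomm (a₁ , a₂ , a₃) (b₁ , b₂ , b₃) =
  cong₂ _,_ (identity a₁ b₁) (cong₂ _,_ (identity a₂ b₂) (identity a₃ b₃))
  where
  open import Data.Integer using (_-_; -_)
  identity : ∀ i j → i - j ≡ - (j - i)
  identity = solve-∀

⊖-reflectCube : ∀ w a b → reflectCube w a ⊖ reflectCube w b ≡ mirror w (a ⊖ b)
⊖-reflectCube X (a₁ , _ , _) (b₁ , _ , _) = cong₂ _,_ (reflectℤ-minus a₁ b₁) refl
⊖-reflectCube Y (_ , a₂ , _) (_ , b₂ , _) = cong₂ _,_ refl (cong₂ _,_ (reflectℤ-minus a₂ b₂) refl)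
⊖-reflectCube Z (_ , _ , a₃) (_ , _ , b₃) = cong₂ _,_ refl (cong₂ _,_ refl (reflectℤ-minus a₃ b₃))

reflectCube-involutive : ∀ w c → reflectCube w (reflectCube w c) ≡ c
reflectCube-involutive X (x , y , z) = cong₂ _,_ (reflectℤ-involutive x) refl
reflectCube-involutive Y (x , y , z) = cong₂ _,_ refl (cong₂ _,_ (reflectℤ-involutive y) refl)
reflectCube-involutive Z (x , y , z) = cong₂ _,_ refl (cong₂ _,_ refl (reflectℤ-involutive z))

reflectCube-injective : ∀ w {c c′} → reflectCube w c ≡ reflectCube w c′ → c ≡ c′
reflectCube-injective w {c} {c′} rc≡rc′ =
  trans (sym (reflectCube-involutive w c))
        (trans (cong (reflectCube w) rc≡rc′) (reflectCube-involutive w c′))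

v-reflectDomino : ∀ w d → v (reflectDomino w d) ≡ mirror w (-ᵖ v d)
v-reflectDomino w (c₁ , c₂) rewrite isBlack-reflectCube w c₁ with isBlack c₁
... | true  = trans (⊖-reflectCube w c₂ c₁) (cong (mirror w) (⊖-anticomm c₂ c₁))
... | false = trans (⊖-reflectCube w c₁ c₂) (cong (mirror w) (⊖-anticomm c₁ c₂))

det-diagonal : ∀ a c → det a a c ≡ + 0
det-diagonal (a₁ , a₂ , a₃) (c₁ , c₂ , c₃) = identity a₁ a₂ a₃ c₁ c₂ c₃
  where
  open import Data.Integer using (_+_; _*_; _-_)
  identity : ∀ a₁ a₂ a₃ c₁ c₂ c₃ →
    a₁ * (a₂ * c₃ - a₃ * c₂) + a₂ * (a₃ * c₁ - a₁ * c₃) + a₃ * (a₁ * c₂ - a₂ * c₁) ≡ + 0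
  identity = solve-∀

det-swap : ∀ a b c → det a b (-ᵖ c) ≡ det b a c
det-swap (a₁ , a₂ , a₃) (b₁ , b₂ , b₃) (c₁ , c₂ , c₃) = identity a₁ a₂ a₃ b₁ b₂ b₃ c₁ c₂ c₃
  where
  open import Data.Integer using (_+_; _*_; _-_; -_)
  identity : ∀ a₁ a₂ a₃ b₁ b₂ b₃ c₁ c₂ c₃ →
    a₁ * (b₂ * - c₃ - b₃ * - c₂) + a₂ * (b₃ * - c₁ - b₁ * - c₃) + a₃ * (b₁ * - c₂ - b₂ * - c₁)
    ≡ b₁ * (a₂ * c₃ - a₃ * c₂) + b₂ * (a₃ * c₁ - a₁ * c₃) + b₃ * (a₁ * c₂ - a₂ * c₁)
  identity = solve-∀

det-mirror-negate : ∀ w a b c → det (mirror w (-ᵖ a)) (mirror w (-ᵖ b)) c ≡ ℤ.- det a b (mirror w c)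
det-mirror-negate X (a₁ , a₂ , a₃) (b₁ , b₂ , b₃) (c₁ , c₂ , c₃) = identity a₁ a₂ a₃ b₁ b₂ b₃ c₁ c₂ c₃
  where
  open import Data.Integer using (_+_; _*_; _-_; -_)
  identity : ∀ a₁ a₂ a₃ b₁ b₂ b₃ c₁ c₂ c₃ →
    - - a₁ * (- b₂ * c₃ - - b₃ * c₂) + - a₂ * (- b₃ * c₁ - - - b₁ * c₃) + - a₃ * (- - b₁ * c₂ - - b₂ * c₁)
    ≡ - (a₁ * (b₂ * c₃ - b₃ * c₂) + a₂ * (b₃ * - c₁ - b₁ * c₃) + a₃ * (b₁ * c₂ - b₂ * - c₁))
  identity = solve-∀
det-mirror-negate Y (a₁ , a₂ , a₃) (b₁ , b₂ , b₃) (c₁ , c₂ , c₃) = identity a₁ a₂ a₃ b₁ b₂ b₃ c₁ c₂ c₃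
  where
  open import Data.Integer using (_+_; _*_; _-_; -_)
  identity : ∀ a₁ a₂ a₃ b₁ b₂ b₃ c₁ c₂ c₃ →
    - a₁ * (- - b₂ * c₃ - - b₃ * c₂) + - - a₂ * (- b₃ * c₁ - - b₁ * c₃) + - a₃ * (- b₁ * c₂ - - - b₂ * c₁)
    ≡ - (a₁ * (b₂ * c₃ - b₃ * - c₂) + a₂ * (b₃ * c₁ - b₁ * c₃) + a₃ * (b₁ * - c₂ - b₂ * c₁))
  identity = solve-∀
det-mirror-negate Z (a₁ , a₂ , a₃) (b₁ , b₂ , b₃) (c₁ , c₂ , c₃) = identity a₁ a₂ a₃ b₁ b₂ b₃ c₁ c₂ c₃
  where
  open import Data.Integer using (_+_; _*_; _-_; -_)
  identity : ∀ a₁ a₂ a₃ b₁ b₂ b₃ c₁ c₂ c₃ →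
    - a₁ * (- b₂ * c₃ - - - b₃ * c₂) + - a₂ * (- - b₃ * c₁ - - b₁ * c₃) + - - a₃ * (- b₁ * c₂ - - b₂ * c₁)
    ≡ - (a₁ * (b₂ * - c₃ - b₃ * c₂) + a₂ * (b₃ * c₁ - b₁ * - c₃) + a₃ * (b₁ * c₂ - b₂ * c₁))
  identity = solve-∀

==ᵖ-sound : ∀ {c c′} → T (c ==ᵖ c′) → c ≡ c′
==ᵖ-sound {x , y , z} {x′ , y′ , z′} eq =
  let x≡x′ , eq-yz = to (T-∧ {x ==ℤ x′}) eq
      y≡y′ , z≡z′ = to (T-∧ {y ==ℤ y′}) eq-yz
  in cong₂ _,_ (toWitness x≡x′) (cong₂ _,_ (toWitness y≡y′) (toWitness z≡z′))

==ᵖ-complete : ∀ {c c′} → c ≡ c′ → T (c ==ᵖ c′)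
==ᵖ-complete {x , y , z} refl =
  from (T-∧ {x ==ℤ x}) (fromWitness refl , from (T-∧ {y ==ℤ y}) (fromWitness refl , fromWitness refl))

_≟ᶜ_ : DecidableEquality Cube
c ≟ᶜ c′ = (c ==ᵖ c′) because fromEquivalence ==ᵖ-sound ==ᵖ-complete

cubeIn-false : ∀ {c d} → ¬ InDomino c d → cubeIn c d ≡ false
cubeIn-false {c} {c₁ , c₂} c∉d =
  cong₂ _∨_ (dec-false (c ≟ᶜ c₁) (c∉d ∘ inj₁)) (dec-false (c ≟ᶜ c₂) (c∉d ∘ inj₂))

cubeIn-reflect : ∀ w c d → cubeIn (reflectCube w c) (reflectDomino w d) ≡ cubeIn c d
cubeIn-reflect w c (c₁ , c₂) = cong₂ _∨_ (==ᵖ-reflect c₁) (==ᵖ-reflect c₂)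
  where
  ==ᵖ-reflect : ∀ c′ → (reflectCube w c ==ᵖ reflectCube w c′) ≡ (c ==ᵖ c′)
  ==ᵖ-reflect c′ = does-⇔ (mk⇔ (reflectCube-injective w) (cong (reflectCube w)))
                          (reflectCube w c ≟ᶜ reflectCube w c′) (c ≟ᶜ c′)

isYes-⇔ : ∀ {a b} {A : Set a} {B : Set b} → A ⇔ B → (a? : Dec A) (b? : Dec B) → ⌊ a? ⌋ ≡ ⌊ b? ⌋
isYes-⇔ A⇔B a? b? = trans (isYes≗does a?) (trans (does-⇔ A⇔B a? b?) (sym (isYes≗does b?)))

0<-neg : ∀ x → (+ 0 <ℤ ℤ.- x) ≡ (x <ℤ + 0)
0<-neg x = isYes-⇔ (mk⇔ ℤP.neg-cancel-< ℤP.neg-mono-<) _ _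

neg<0 : ∀ x → (ℤ.- x <ℤ + 0) ≡ (+ 0 <ℤ x)
neg<0 x = isYes-⇔ (mk⇔ ℤP.neg-cancel-< ℤP.neg-mono-<) _ _

neg==0 : ∀ x → (ℤ.- x ==ℤ + 0) ≡ (x ==ℤ + 0)
neg==0 x = isYes-⇔ (mk⇔ ℤP.neg-injective (cong (ℤ.-_))) _ _

positiveMultiple-negate : ∀ u p → positiveMultiple u (-ᵖ p) ≡ positiveMultiple (opposite u) p
positiveMultiple-negate px (x , y , z) rewrite 0<-neg x | neg==0 y | neg==0 z = refl
positiveMultiple-negate nx (x , y , z) rewrite neg<0 x | neg==0 y | neg==0 z = refl
positiveMultiple-negate py (x , y , z) rewrite neg==0 x | 0<-neg y | neg==0 z = refl
positiveMultiple-negate ny (x , y , z) rewrite neg==0 x | neg<0 y | neg==0 z = refl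
positiveMultiple-negate pz (x , y , z) rewrite neg==0 x | neg==0 y | 0<-neg z = refl
positiveMultiple-negate nz (x , y , z) rewrite neg==0 x | neg==0 y | neg<0 z = refl

positiveMultiple-mirror : ∀ w u p → positiveMultiple u (mirror w p) ≡ positiveMultiple (mirrorDir w u) p
positiveMultiple-mirror X px (x , y , z) rewrite 0<-neg x = refl
positiveMultiple-mirror X nx (x , y , z) rewrite neg<0 x = refl
positiveMultiple-mirror X py (x , y , z) rewrite neg==0 x = refl
positiveMultiple-mirror X ny (x , y , z) rewrite neg==0 x = refl
positiveMultiple-mirror X pz (x , y , z) rewrite neg==0 x = refl
positiveMultiple-mirror X nz (x , y , z) rewrite neg==0 x = refl
positiveMultiple-mirror Y px (x , y , z) rewrite neg==0 y = refl
positiveMultiple-mirror Y nx (x , y , z) rewrite neg==0 y = refl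
positiveMultiple-mirror Y py (x , y , z) rewrite 0<-neg y = refl
positiveMultiple-mirror Y ny (x , y , z) rewrite neg<0 y = refl
positiveMultiple-mirror Y pz (x , y , z) rewrite neg==0 y = refl
positiveMultiple-mirror Y nz (x , y , z) rewrite neg==0 y = refl
positiveMultiple-mirror Z px (x , y , z) rewrite neg==0 z = refl
positiveMultiple-mirror Z nx (x , y , z) rewrite neg==0 z = refl
positiveMultiple-mirror Z py (x , y , z) rewrite neg==0 z = refl
positiveMultiple-mirror Z ny (x , y , z) rewrite neg==0 z = refl
positiveMultiple-mirror Z pz (x , y , z) rewrite 0<-neg z = refl
positiveMultiple-mirror Z nz (x , y , z) rewrite neg<0 z = refl

positiveMultiple-⊖-swap : ∀ u c c′ → positiveMultiple (opposite u) (c ⊖ c′) ≡ positiveMultiple u (c′ ⊖ c)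
positiveMultiple-⊖-swap u c c′ =
  sym (trans (cong (positiveMultiple u) (⊖-anticomm c′ c)) (positiveMultiple-negate u (c ⊖ c′)))

Disjoint-sym : Symmetric Disjoint
Disjoint-sym d∩e=∅ c c∈e c∈d = d∩e=∅ c c∈d c∈e

any-cubeList-reflect : ∀ w (p : Cube → Bool) {q} d → (∀ c → p (reflectCube w c) ≡ q c) →
                       any p (cubeList (reflectDomino w d)) ≡ any q (cubeList d)
any-cubeList-reflect w p (c₁ , c₂) p∘r≡q = cong₂ _∨_ (p∘r≡q c₁) (cong (_∨ false) (p∘r≡q c₂))

shadowTest : Dir → Domino → Cube → Cube → Bool
shadowTest u d₀ c₁ c₀ = positiveMultiple u (c₁ ⊖ c₀) ∧ not (cubeIn c₁ d₀)

shadowTest-reflect : ∀ w u d₀ c₁ c₀ →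
  shadowTest u (reflectDomino w d₀) (reflectCube w c₁) (reflectCube w c₀) ≡ shadowTest (mirrorDir w u) d₀ c₁ c₀
shadowTest-reflect w u d₀ c₁ c₀ =
  cong₂ (λ p q → p ∧ not q)
        (trans (cong (positiveMultiple u) (⊖-reflectCube w c₁ c₀)) (positiveMultiple-mirror w u (c₁ ⊖ c₀)))
        (cubeIn-reflect w c₁ d₀)

meetsShadow-reflect : ∀ w u d₀ d₁ →
  meetsShadow u (reflectDomino w d₀) (reflectDomino w d₁) ≡ meetsShadow (mirrorDir w u) d₀ d₁
meetsShadow-reflect w u d₀ d₁ =
  any-cubeList-reflect w (λ c₁ → any (shadowTest u r[d₀] c₁) (cubeList r[d₀])) d₁ λ c₁ →
  any-cubeList-reflect w (shadowTest u r[d₀] (reflectCube w c₁)) d₀ λ c₀ →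
  shadowTest-reflect w u d₀ c₁ c₀
  where
  r[d₀] : Domino
  r[d₀] = reflectDomino w d₀

meetsRay : Dir → Domino → Domino → Bool
meetsRay u d₀ d₁ =
  any (λ c₁ → any (λ c₀ → positiveMultiple u (c₁ ⊖ c₀)) (cubeList d₀)) (cubeList d₁)

meetsShadow-disjoint : ∀ u {d₀ d₁} → Disjoint d₀ d₁ → meetsShadow u d₀ d₁ ≡ meetsRay u d₀ d₁
meetsShadow-disjoint u {d₀} {a₁ , b₁} d₀∩d₁=∅ =
  cong₂ (λ p q → p ∨ q ∨ false) (unguard a₁ (inj₁ refl)) (unguard b₁ (inj₂ refl))
  where
  unguard : ∀ c → InDomino c (a₁ , b₁) →
            any (shadowTest u d₀ c) (cubeList d₀) ≡ any (λ c₀ → positiveMultiple u (c ⊖ c₀)) (cubeList d₀)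
  unguard c c∈d₁ rewrite cubeIn-false {c} {d₀} (λ c∈d₀ → d₀∩d₁=∅ c c∈d₀ c∈d₁) =
    any-cong-local (cubeList d₀) λ {c₀} _ → ∧-identityʳ (positiveMultiple u (c ⊖ c₀))

meetsRay-opposite : ∀ u d₀ d₁ → meetsRay (opposite u) d₀ d₁ ≡ meetsRay u d₁ d₀
meetsRay-opposite u d₀ d₁ =
  trans (any-comm (λ c₁ c₀ → positiveMultiple (opposite u) (c₁ ⊖ c₀)) (cubeList d₁) (cubeList d₀))
        (any-cong-local (cubeList d₀) λ {c₀} _ → any-cong-local (cubeList d₁) λ {c₁} _ →
          positiveMultiple-⊖-swap u c₁ c₀)

meetsShadow-opposite : ∀ u {d₀ d₁} → Disjoint d₀ d₁ →
                       meetsShadow (opposite u) d₀ d₁ ≡ meetsShadow u d₁ d₀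
meetsShadow-opposite u {d₀} {d₁} d₀∩d₁=∅ = begin
  meetsShadow (opposite u) d₀ d₁  ≡⟨ meetsShadow-disjoint (opposite u) d₀∩d₁=∅ ⟩
  meetsRay (opposite u) d₀ d₁     ≡⟨ meetsRay-opposite u d₀ d₁ ⟩
  meetsRay u d₁ d₀                ≡⟨ meetsShadow-disjoint u (Disjoint-sym d₀∩d₁=∅) ⟨
  meetsShadow u d₁ d₀             ∎
  where open ≡-Reasoning

open import Data.Rational using (-_)
open import Algebra.Properties.Group ℚP.+-0-group using (⁻¹-involutive)
open ListSum ℚP.+-0-commutativeMonoid using (∑; ∑-comm; ∑-cong-local; ∑-map-cong)

∑-neg : ∀ {a} {A : Set a} (f : A → ℚ) xs → ∑ (λ x → - f x) xs ≡ - ∑ f xs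
∑-neg f []       = refl
∑-neg f (x ∷ xs) = trans (cong (- f x ℚ.+_) (∑-neg f xs)) (sym (ℚP.neg-distrib-+ (f x) (∑ f xs)))

-- pretwist u t unfolds to ∑∑ (τ u) t.
∑∑ : ∀ {a} {A : Set a} → (A → A → ℚ) → List A → ℚ
∑∑ f xs = ∑ (λ x → ∑ (f x) xs) xs

∑∑-map : ∀ {a b} {A : Set a} {B : Set b} (f : B → B → ℚ) (g : A → B) xs →
         ∑∑ f (map g xs) ≡ ∑∑ (λ x y → f (g x) (g y)) xs
∑∑-map f g xs = ∑-map-cong g (λ x → ∑-map-cong g (λ _ → refl) xs) xs

∑∑-neg : ∀ {a} {A : Set a} (f : A → A → ℚ) xs → ∑∑ (λ x y → - f x y) xs ≡ - ∑∑ f xs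
∑∑-neg f xs = trans (∑-cong-local xs λ {x} _ → ∑-neg (f x) xs) (∑-neg _ xs)

∑∑-transpose : ∀ {a} {A : Set a} (f : A → A → ℚ) xs → ∑∑ (flip f) xs ≡ ∑∑ f xs
∑∑-transpose f xs = ∑-comm (flip f) xs xs

∑∑-cong-local : ∀ {a} {A : Set a} {f g : A → A → ℚ} xs →
                (∀ {x y} → x ∈ xs → y ∈ xs → f x y ≡ g x y) → ∑∑ f xs ≡ ∑∑ g xs
∑∑-cong-local xs f≡g = ∑-cong-local xs λ x∈xs → ∑-cong-local xs λ y∈xs → f≡g x∈xs y∈xs

-- τ u d₀ d₁ unfolds to quarterIf (meetsShadow u d₀ d₁) (det (v d₁) (v d₀) (vec u)).
quarterIf : Bool → ℤ → ℚ
quarterIf b i = if b then i / 4 else 0ℚ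

quarterIf-zero : ∀ b → quarterIf b (+ 0) ≡ 0ℚ
quarterIf-zero b = if-eta b

quarterIf-neg : ∀ b i → quarterIf b (ℤ.- i) ≡ - quarterIf b i
quarterIf-neg false i          = refl
quarterIf-neg true  (+ 0)      = refl
quarterIf-neg true  +[1+ n ]   = refl
quarterIf-neg true  -[1+ n ]   = sym (⁻¹-involutive _)

τ-diagonal : ∀ u d → τ u d d ≡ 0ℚ
τ-diagonal u d =
  trans (cong (quarterIf (meetsShadow u d d)) (det-diagonal (v d) (vec u))) (quarterIf-zero _)

τ-opposite : ∀ u {d₀ d₁} → d₀ ≡ d₁ ⊎ Disjoint d₀ d₁ → τ (opposite u) d₀ d₁ ≡ τ u d₁ d₀
τ-opposite u {d₀} (inj₁ refl) = trans (τ-diagonal (opposite u) d₀) (sym (τ-diagonal u d₀))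
τ-opposite u {d₀} {d₁} (inj₂ d₀∩d₁=∅) =
  cong₂ quarterIf (meetsShadow-opposite u d₀∩d₁=∅)
                  (trans (cong (det (v d₁) (v d₀)) (vec-opposite u)) (det-swap (v d₁) (v d₀) (vec u)))

τ-reflect : ∀ w u d₀ d₁ →
            τ u (reflectDomino w d₀) (reflectDomino w d₁) ≡ - τ (mirrorDir w u) d₀ d₁
τ-reflect w u d₀ d₁ =
  trans (cong₂ quarterIf (meetsShadow-reflect w u d₀ d₁) det-reflect)
        (quarterIf-neg (meetsShadow (mirrorDir w u) d₀ d₁) (det (v d₁) (v d₀) (vec (mirrorDir w u))))
  where
  open ≡-Reasoning
  det-reflect : det (v (reflectDomino w d₁)) (v (reflectDomino w d₀)) (vec u)
                ≡ ℤ.- det (v d₁) (v d₀) (vec (mirrorDir w u))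
  det-reflect = begin
    det (v (reflectDomino w d₁)) (v (reflectDomino w d₀)) (vec u)
      ≡⟨ cong₂ (λ a b → det a b (vec u)) (v-reflectDomino w d₁) (v-reflectDomino w d₀) ⟩
    det (mirror w (-ᵖ v d₁)) (mirror w (-ᵖ v d₀)) (vec u)
      ≡⟨ det-mirror-negate w (v d₁) (v d₀) (vec u) ⟩
    ℤ.- det (v d₁) (v d₀) (mirror w (vec u))
      ≡⟨ cong (λ c → ℤ.- det (v d₁) (v d₀) c) (vec-mirrorDir w u) ⟨
    ℤ.- det (v d₁) (v d₀) (vec (mirrorDir w u)) ∎

pretwist-reflect : ∀ w u t → pretwist u (map (reflectDomino w) t) ≡ - pretwist (mirrorDir w u) t
pretwist-reflect w u t = begin
  ∑∑ (τ u) (map r t)                        ≡⟨ ∑∑-map (τ u) r t ⟩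
  ∑∑ (λ d₀ d₁ → τ u (r d₀) (r d₁)) t         ≡⟨ ∑∑-cong-local t (λ {d₀} {d₁} _ _ → τ-reflect w u d₀ d₁) ⟩
  ∑∑ (λ d₀ d₁ → - τ (mirrorDir w u) d₀ d₁) t  ≡⟨ ∑∑-neg (τ (mirrorDir w u)) t ⟩
  - ∑∑ (τ (mirrorDir w u)) t                 ∎
  where
  open ≡-Reasoning
  r : Domino → Domino
  r = reflectDomino w

pretwist-opposite : ∀ u {t} → AllPairs Disjoint t → pretwist (opposite u) t ≡ pretwist u t
pretwist-opposite u {t} pairwise-disjoint =
  trans (∑∑-cong-local t λ d₀∈t d₁∈t →
           τ-opposite u (AllPairs-lookup Disjoint-sym pairwise-disjoint d₀∈t d₁∈t))
        (∑∑-transpose (τ u) t)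

pretwist-mirrorDir : ∀ w u {t} → AllPairs Disjoint t → pretwist (mirrorDir w u) t ≡ pretwist u t
pretwist-mirrorDir w u {t} pairwise-disjoint with mirrorDir≡id⊎opposite w u
... | inj₁ ρu≡u  = cong (λ u′ → pretwist u′ t) ρu≡u
... | inj₂ ρu≡-u = trans (cong (λ u′ → pretwist u′ t) ρu≡-u) (pretwist-opposite u pairwise-disjoint)

lemma3p2 : (R : Region) (w : Axis) (t : List Domino) → IsTiling R t →
    (u : Dir) → pretwist u (map (reflectDomino w) t) ≡ - pretwist u t
lemma3p2 R w t (_ , pairwise-disjoint , _) u = begin
  pretwist u (map (reflectDomino w) t)  ≡⟨ pretwist-reflect w u t ⟩
  - pretwist (mirrorDir w u) t          ≡⟨ cong -_ (pretwist-mirrorDir w u pairwise-disjoint) ⟩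
  - pretwist u t                        ∎
  where open ≡-Reasoning
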